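{- For every positive integer $n$, let $T_n\subset S_n$ be the set of $2$-standard consecutive $n$-cycles. Then $\#(T_n)=2^{n-1}-n$.
   Context: Write an $n$-cycle of $S_n$ as $(a_1=1,a_2,\ldots,a_n)$ and consider the word $a_1a_2\cdots a_n$. Its consecutive standard structure is a partition of $\{1,\ldots,n\}$ into blocks of consecutive integers $\{c,c+1,\ldots,c+r\}$ such that within each block these integers occur from left to right in increasing order in the word, the number of blocks being minimal among all such partitions. The cycle is $2$-standard consecutive if this minimal number of blocks equals $2$. -}

module Defs where

open import Data.Nat using (ℕ; zero; suc; _+_; _<_; _≤_)
open import Data.Fin using (Fin; toℕ)
open import Data.Vec using (Vec; lookup)
open import Data.List using (List; []; _∷_; length)
open import Data.Nat.ListAction using (sum)
open import Data.Product using (Σ; ∃; _×_)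
open import Data.Unit using (⊤)
open import Relation.Binary.PropositionalEquality using (_≡_)
open import Function.Definitions using (Injective)

-- A word a₁a₂⋯aₙ over {1,…,n}; the value k+1 is encoded by the element
-- of Fin n with toℕ = k, position i+1 likewise by index i.
Word : ℕ → Set
Word n = Vec (Fin n) n

-- The word of an n-cycle (a₁ = 1, a₂, …, aₙ) of Sₙ: the entries are
-- pairwise distinct (so the word is a permutation of {1,…,n}) and a₁ = 1.
IsCycleWord : ∀ {n} → Word n → Set
IsCycleWord {n} w =
  Injective _≡_ _≡_ (lookup w) × (∀ (z : Fin n) → toℕ z ≡ 0 → lookup w z ≡ z)

Before : ∀ {n} → Word n → Fin n → Fin n → Set
Before {n} w a b =
  Σ (Fin n) λ p → Σ (Fin n) λ q → toℕ p < toℕ q × lookup w p ≡ a × lookup w q ≡ b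

IncreasingBlock : ∀ {n} → Word n → ℕ → ℕ → Set
IncreasingBlock {n} w s ℓ =
  ∀ (a b : Fin n) → s ≤ toℕ a → toℕ a < toℕ b → toℕ b < s + ℓ → Before w a b

-- A partition of {0,…,n-1} into blocks of consecutive integers is given by the
-- list of its (positive) block lengths, in order; blocks start at s.
ValidFrom : ∀ {n} → Word n → ℕ → List ℕ → Set
ValidFrom w s [] = ⊤
ValidFrom w s (ℓ ∷ ls) = 0 < ℓ × IncreasingBlock w s ℓ × ValidFrom w (s + ℓ) ls

ValidPartition : ∀ {n} → Word n → List ℕ → Set
ValidPartition {n} w ls = sum ls ≡ n × ValidFrom w 0 ls

MinBlocks : ∀ {n} → Word n → ℕ → Set
MinBlocks w k =
  (Σ (List ℕ) λ ls → ValidPartition w ls × length ls ≡ k)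
  × (∀ ls → ValidPartition w ls → k ≤ length ls)

TwoStandardConsecutive : ∀ {n} → Word n → Set
TwoStandardConsecutive w = IsCycleWord w × MinBlocks w 2

-- Letters are encoded as 0, …, n-1, so a cycle word starts with 0.  A cycle
-- word consisting of the increasing blocks [0, k) and [k, n) is a shuffle of
-- the runs 0, 1, …, k-1 and k, …, n-1, determined by its pattern: the Boolean
-- vector marking the positions of lower letters.  As 0 comes first, the
-- pattern is true ∷ b with b of length m = n-1, and k = 1 + #true b.  Such a
-- word needs two blocks, not one, exactly when it is not increasing, i.e.
-- when b is interleaved (some false precedes some true).  So b ↦ encode b is
-- a bijection from the interleaved vectors of length m onto the 2-standard
-- consecutive cycles, and all but m + 1 of the 2^m vectors are interleaved.
module Submission where

open import Defs
open import Data.Nat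
open import Data.Nat.Properties
open import Data.Bool using (Bool; true; false; if_then_else_)
open import Data.Bool.Properties using () renaming (_≟_ to _≟ᵇ_)
open import Data.Fin using (Fin; zero; suc; toℕ; fromℕ<; punchOut)
open import Data.Fin.Properties using (toℕ-injective; toℕ<n; toℕ-fromℕ<; pigeonhole; punchOut-injective; any?)
  renaming (_≟_ to _≟ᶠ_)
open import Data.Vec as Vec using (Vec; []; _∷_; lookup; tail)
open import Data.Vec.Properties using (lookup-map; ∷-injective; ∷-injectiveʳ)
open import Data.Vec.Relation.Unary.All as All using (All; []; _∷_)
open import Data.Vec.Relation.Unary.All.Properties using (lookup⁺; lookup⁻; map⁺)
open import Data.Vec.Relation.Unary.AllPairs using (AllPairs; []; _∷_)
open import Data.Vec.Relation.Unary.Any as Any using (Any; here; there)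
open import Data.Vec.Membership.Propositional using () renaming (_∈_ to _∈ᵥ_)
open import Data.Vec.Membership.Propositional.Properties using (∈-lookup)
open import Data.List as List using (List; []; _∷_; length)
open import Data.List.Properties using (length-++; length-map; map-∘; map-id-local)
open import Data.List.Relation.Unary.Unique.Propositional using (Unique; []; _∷_)
import Data.List.Relation.Unary.Unique.Propositional.Properties as Unique
import Data.List.Relation.Unary.All as ListAll
import Data.List.Relation.Unary.Any as ListAny
open import Data.List.Membership.Propositional using (_∈_)
open import Data.List.Membership.Propositional.Properties using (∈-map⁺; ∈-map⁻; ∈-++⁺ˡ; ∈-++⁺ʳ; ∈-++⁻)
open import Data.Product using (Σ; _×_; _,_; proj₁; proj₂)
open import Data.Sum using (_⊎_; inj₁; inj₂; [_,_]′)
open import Data.Unit using (tt)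
open import Function using (_∘_; id)
open import Function.Bundles using (_⇔_; mk⇔)
open import Function.Definitions using (Injective)
open import Relation.Nullary using (¬_; Dec; yes; no; contradiction)
import Relation.Nullary.Decidable as Dec
open import Relation.Nullary.Decidable using (⌊_⌋; isYes≗does; dec-true)
open import Relation.Binary.Definitions using (tri<; tri≈; tri>)
open import Relation.Binary.PropositionalEquality

#true : ∀ {j} → Vec Bool j → ℕ
#true [] = 0
#true (true ∷ c) = suc (#true c)
#true (false ∷ c) = #true c

#false : ∀ {j} → Vec Bool j → ℕ
#false [] = 0
#false (true ∷ c) = #false c
#false (false ∷ c) = suc (#false c)

#true+#false : ∀ {j} (c : Vec Bool j) → #true c + #false c ≡ j
#true+#false [] = refl
#true+#false (true ∷ c) = cong suc (#true+#false c)
#true+#false (false ∷ c) = trans (+-suc (#true c) (#false c)) (cong suc (#true+#false c))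

shuffle : ∀ {j} → Vec Bool j → ℕ → ℕ → Vec ℕ j
shuffle [] s t = []
shuffle (true ∷ c) s t = s ∷ shuffle c (suc s) t
shuffle (false ∷ c) s t = t ∷ shuffle c s (suc t)

InRuns : ℕ → ℕ → ℕ → ℕ → ℕ → Set
InRuns s k t N y = (s ≤ y × y < k) ⊎ (t ≤ y × y < N)

module _ {s k t N y : ℕ} where

  widen-lower : InRuns (suc s) k t N y → InRuns s k t N y
  widen-lower (inj₁ (s<y , y<k)) = inj₁ (<⇒≤ s<y , y<k)
  widen-lower (inj₂ inUpper) = inj₂ inUpper

  widen-upper : InRuns s k (suc t) N y → InRuns s k t N y
  widen-upper (inj₁ inLower) = inj₁ inLower
  widen-upper (inj₂ (t<y , y<N)) = inj₂ (<⇒≤ t<y , y<N)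

  narrow-lower : s ≢ y → InRuns s k t N y → InRuns (suc s) k t N y
  narrow-lower s≢y (inj₁ (s≤y , y<k)) = inj₁ (≤∧≢⇒< s≤y s≢y , y<k)
  narrow-lower _ (inj₂ inUpper) = inj₂ inUpper

  narrow-upper : t ≢ y → InRuns s k t N y → InRuns s k (suc t) N y
  narrow-upper _ (inj₁ inLower) = inj₁ inLower
  narrow-upper t≢y (inj₂ (t≤y , y<N)) = inj₂ (≤∧≢⇒< t≤y t≢y , y<N)

module _ {k n y : ℕ} where

  <⇒inRuns : y < n → InRuns 0 k k n y
  <⇒inRuns y<n with y <? k
  ... | yes y<k = inj₁ (z≤n , y<k)
  ... | no y≮k = inj₂ (≮⇒≥ y≮k , y<n)

  inRuns⇒< : k ≤ n → InRuns 0 k k n y → y < n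
  inRuns⇒< k≤n (inj₁ (_ , y<k)) = <-≤-trans y<k k≤n
  inRuns⇒< _ (inj₂ (_ , y<n)) = y<n

-- x may precede y in a word whose letters below k and whose letters
-- from k on both occur in increasing order.
RunOrdered : ℕ → ℕ → ℕ → Set
RunOrdered k x y = (x < k → y < k → x < y) × (k ≤ x → k ≤ y → x < y)

RunOrdered⇒≢ : ∀ {k x y} → RunOrdered k x y → x ≢ y
RunOrdered⇒≢ {k} {x} (lower , upper) refl with x <? k
... | yes x<k = n≮n x (lower x<k x<k)
... | no x≮k = n≮n x (upper (≮⇒≥ x≮k) (≮⇒≥ x≮k))

classify : ∀ {j} → ℕ → Vec ℕ j → Vec Bool j
classify k = Vec.map (λ x → ⌊ x <? k ⌋)

shift-lower : ∀ {k} s n → s + suc n ≤ k → suc s + n ≤ k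
shift-lower s n = ≤-trans (≤-reflexive (sym (+-suc s n)))

module _ (k : ℕ) where

  shuffle-inRuns : ∀ {j} (c : Vec Bool j) s t → s + #true c ≤ k →
                   All (InRuns s k t (t + #false c)) (shuffle c s t)
  shuffle-inRuns [] s t _ = []
  shuffle-inRuns (true ∷ c) s t s+#≤k =
    inj₁ (≤-refl , m+n≤o⇒m≤o _ (shift-lower s _ s+#≤k))
    ∷ All.map widen-lower (shuffle-inRuns c (suc s) t (shift-lower s _ s+#≤k))
  shuffle-inRuns (false ∷ c) s t s+#≤k =
    inj₂ (≤-refl , subst (t <_) N≡ (s≤s (m≤m+n t (#false c))))
    ∷ All.map (λ {y} → subst (λ N → InRuns s k t N y) N≡ ∘ widen-upper) (shuffle-inRuns c s (suc t) s+#≤k)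
    where
    N≡ : suc t + #false c ≡ t + suc (#false c)
    N≡ = sym (+-suc t (#false c))

  runOrdered-< : ∀ {x y} → x < k → x < y → RunOrdered k x y
  runOrdered-< x<k x<y = (λ _ _ → x<y) , (λ k≤x _ → contradiction x<k (≤⇒≯ k≤x))

  runOrdered-≥ : ∀ {x y} → k ≤ x → (k ≤ y → x < y) → RunOrdered k x y
  runOrdered-≥ k≤x upper = (λ x<k _ → contradiction x<k (≤⇒≯ k≤x)) , (λ _ → upper)

  shuffle-runOrdered : ∀ {j} (c : Vec Bool j) s t → s + #true c ≤ k → k ≤ t →
                       AllPairs (RunOrdered k) (shuffle c s t)
  shuffle-runOrdered [] s t _ _ = []
  shuffle-runOrdered (true ∷ c) s t s+#≤k k≤t =
    All.map after-s (shuffle-inRuns c (suc s) t s+#≤k′) ∷ shuffle-runOrdered c (suc s) t s+#≤k′ k≤t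
    where
    s+#≤k′ = shift-lower s _ s+#≤k
    s<k : s < k
    s<k = m+n≤o⇒m≤o _ s+#≤k′
    after-s : ∀ {y} → InRuns (suc s) k t (t + #false c) y → RunOrdered k s y
    after-s (inj₁ (s<y , _)) = runOrdered-< s<k s<y
    after-s (inj₂ (t≤y , _)) = runOrdered-< s<k (<-≤-trans s<k (≤-trans k≤t t≤y))
  shuffle-runOrdered (false ∷ c) s t s+#≤k k≤t =
    All.map after-t (shuffle-inRuns c s (suc t) s+#≤k)
    ∷ shuffle-runOrdered c s (suc t) s+#≤k (m≤n⇒m≤1+n k≤t)
    where
    after-t : ∀ {y} → InRuns s k (suc t) (suc t + #false c) y → RunOrdered k t y
    after-t (inj₁ (_ , y<k)) = runOrdered-≥ k≤t (λ k≤y → contradiction y<k (≤⇒≯ k≤y))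
    after-t (inj₂ (t<y , _)) = runOrdered-≥ k≤t (λ _ → t<y)

  classify-shuffle : ∀ {j} (c : Vec Bool j) s t → s + #true c ≤ k → k ≤ t →
                     classify k (shuffle c s t) ≡ c
  classify-shuffle [] s t _ _ = refl
  classify-shuffle (true ∷ c) s t s+#≤k k≤t with s <? k
  ... | yes _ = cong (true ∷_) (classify-shuffle c (suc s) t (shift-lower s _ s+#≤k) k≤t)
  ... | no s≮k = contradiction (m+n≤o⇒m≤o _ (shift-lower s _ s+#≤k)) s≮k
  classify-shuffle (false ∷ c) s t s+#≤k k≤t with t <? k
  ... | yes t<k = contradiction k≤t (<⇒≱ t<k)
  ... | no _ = cong (false ∷_) (classify-shuffle c s (suc t) s+#≤k (m≤n⇒m≤1+n k≤t))

shuffle-covers : ∀ {j} (c : Vec Bool j) s t y →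
                 InRuns s (s + #true c) t (t + #false c) y → y ∈ᵥ shuffle c s t
shuffle-covers [] s t y (inj₁ (s≤y , y<s+0)) = contradiction (subst (s <_) (+-identityʳ s) (≤-<-trans s≤y y<s+0)) (n≮n s)
shuffle-covers [] s t y (inj₂ (t≤y , y<t+0)) = contradiction (subst (t <_) (+-identityʳ t) (≤-<-trans t≤y y<t+0)) (n≮n t)
shuffle-covers (true ∷ c) s t y inRuns with y ≟ s
... | yes refl = here refl
... | no y≢s = there (shuffle-covers c (suc s) t y
                 (subst (λ k → InRuns (suc s) k t (t + #false c) y) (+-suc s (#true c)) (narrow-lower (y≢s ∘ sym) inRuns)))
shuffle-covers (false ∷ c) s t y inRuns with y ≟ t
... | yes refl = here refl
... | no y≢t = there (shuffle-covers c s (suc t) y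
                 (subst (λ N → InRuns s (s + #true c) (suc t) N y) (+-suc t (#false c)) (narrow-upper (y≢t ∘ sym) inRuns)))

∈-head : ∀ {j a x} {v : Vec ℕ j} → a ∈ᵥ x ∷ v → ¬ a ∈ᵥ v → a ≡ x
∈-head (here a≡x) _ = a≡x
∈-head (there a∈v) a∉v = contradiction a∈v a∉v

module _ (k : ℕ) where

  TwoRunWord : ∀ {j} → Vec ℕ j → ℕ → ℕ → ℕ → Set
  TwoRunWord v s t N = AllPairs (RunOrdered k) v × All (InRuns s k t N) v × (∀ y → InRuns s k t N y → y ∈ᵥ v)

  lower-head : ∀ {j x s t N} {v : Vec ℕ j} → k ≤ t → x < k →
               TwoRunWord (x ∷ v) s t N → x ≡ s × TwoRunWord v (suc s) t N
  lower-head {x = x} {s} {t} {N} {v} k≤t x<k (x≺v ∷ ordered , x∈runs ∷ v∈runs , covers) = x≡s , ordered , v∈runs′ , covers′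
    where
    s≤x : s ≤ x
    s≤x = [ proj₁ , (λ (t≤x , _) → contradiction (≤-trans k≤t t≤x) (<⇒≱ x<k)) ]′ x∈runs
    s∉v : ¬ s ∈ᵥ v
    s∉v s∈v = <⇒≱ (proj₁ (All.lookup x≺v s∈v) x<k (≤-<-trans s≤x x<k)) s≤x
    x≡s : x ≡ s
    x≡s = sym (∈-head (covers s (inj₁ (≤-refl , ≤-<-trans s≤x x<k))) s∉v)
    v∈runs′ : All (InRuns (suc s) k t N) v
    v∈runs′ = All.map (λ (y∈runs , x≺y) → narrow-lower (subst (_≢ _) x≡s (RunOrdered⇒≢ x≺y)) y∈runs) (All.zip (v∈runs , x≺v))
    ≢x : ∀ {y} → InRuns (suc s) k t N y → y ≢ x
    ≢x (inj₁ (s<y , _)) refl = <⇒≢ s<y (sym x≡s)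
    ≢x (inj₂ (t≤y , _)) refl = contradiction (≤-trans k≤t t≤y) (<⇒≱ x<k)
    covers′ : ∀ y → InRuns (suc s) k t N y → y ∈ᵥ v
    covers′ y y∈runs = Any.tail (≢x y∈runs) (covers y (widen-lower y∈runs))

  upper-head : ∀ {j x s t N} {v : Vec ℕ j} → k ≤ t → k ≤ x →
               TwoRunWord (x ∷ v) s t N → x ≡ t × TwoRunWord v s (suc t) N
  upper-head {x = x} {s} {t} {N} {v} k≤t k≤x (x≺v ∷ ordered , x∈runs ∷ v∈runs , covers) = x≡t , ordered , v∈runs′ , covers′
    where
    x∈upper : t ≤ x × x < N
    x∈upper = [ (λ (_ , x<k) → contradiction x<k (≤⇒≯ k≤x)) , id ]′ x∈runs
    t≤x = proj₁ x∈upper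
    t∉v : ¬ t ∈ᵥ v
    t∉v t∈v = <⇒≱ (proj₂ (All.lookup x≺v t∈v) k≤x k≤t) t≤x
    x≡t : x ≡ t
    x≡t = sym (∈-head (covers t (inj₂ (≤-refl , ≤-<-trans t≤x (proj₂ x∈upper)))) t∉v)
    v∈runs′ : All (InRuns s k (suc t) N) v
    v∈runs′ = All.map (λ (y∈runs , x≺y) → narrow-upper (subst (_≢ _) x≡t (RunOrdered⇒≢ x≺y)) y∈runs) (All.zip (v∈runs , x≺v))
    ≢x : ∀ {y} → InRuns s k (suc t) N y → y ≢ x
    ≢x (inj₁ (_ , y<k)) refl = contradiction y<k (≤⇒≯ k≤x)
    ≢x (inj₂ (t<y , _)) refl = <⇒≢ t<y (sym x≡t)
    covers′ : ∀ y → InRuns s k (suc t) N y → y ∈ᵥ v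
    covers′ y y∈runs = Any.tail (≢x y∈runs) (covers y (widen-upper y∈runs))

  twoRunWord⇒shuffle : ∀ {j} (v : Vec ℕ j) s t N → s ≤ k → k ≤ t → TwoRunWord v s t N →
                       v ≡ shuffle (classify k v) s t × s + #true (classify k v) ≡ k
  twoRunWord⇒shuffle [] s t N s≤k k≤t (_ , _ , covers) with s <? k
  ... | yes s<k with () ← covers s (inj₁ (≤-refl , s<k))
  ... | no s≮k = refl , trans (+-identityʳ s) (≤∧≮⇒≡ s≤k s≮k)
  twoRunWord⇒shuffle (x ∷ v) s t N s≤k k≤t twoRun with x <? k
  ... | yes x<k with lower-head k≤t x<k twoRun
  ...   | refl , twoRun′ with twoRunWord⇒shuffle v (suc x) t N x<k k≤t twoRun′
  ...     | v≡ , #≡ = cong (x ∷_) v≡ , trans (+-suc x _) #≡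
  twoRunWord⇒shuffle (x ∷ v) s t N s≤k k≤t twoRun | no x≮k with upper-head k≤t (≮⇒≥ x≮k) twoRun
  ...   | refl , twoRun′ with twoRunWord⇒shuffle v s (suc x) N s≤k (m≤n⇒m≤1+n k≤t) twoRun′
  ...     | v≡ , #≡ = cong (x ∷_) v≡ , #≡

HasTrue : ∀ {j} → Vec Bool j → Set
HasTrue = Any (_≡ true)

-- Some false precedes some true in c: the pattern c is not of the form
-- true⋯true false⋯false, so its shuffles are not increasing.  The defining
-- recursion is also the one used to enumerate interleaved vectors below.
data Interleaved : ∀ {j} → Vec Bool j → Set where
  true∷_ : ∀ {j} {c : Vec Bool j} → Interleaved c → Interleaved (true ∷ c)
  false∷_ : ∀ {j} {c : Vec Bool j} → HasTrue c → Interleaved (false ∷ c)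

interleaved? : ∀ {j} (c : Vec Bool j) → Dec (Interleaved c)
interleaved? [] = no λ ()
interleaved? (true ∷ c) = Dec.map′ true∷_ (λ { (true∷ i) → i }) (interleaved? c)
interleaved? (false ∷ c) = Dec.map′ false∷_ (λ { (false∷ h) → h }) (Any.any? (_≟ᵇ true) c)

hasTrue⇒#true>0 : ∀ {j} {c : Vec Bool j} → HasTrue c → 0 < #true c
hasTrue⇒#true>0 {c = true ∷ _} _ = s≤s z≤n
hasTrue⇒#true>0 {c = false ∷ _} (there h) = hasTrue⇒#true>0 h

¬hasTrue⇒#true≡0 : ∀ {j} (c : Vec Bool j) → ¬ HasTrue c → #true c ≡ 0
¬hasTrue⇒#true≡0 [] _ = refl
¬hasTrue⇒#true≡0 (true ∷ c) ¬h = contradiction (here refl) ¬h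
¬hasTrue⇒#true≡0 (false ∷ c) ¬h = ¬hasTrue⇒#true≡0 c (¬h ∘ there)

interleaved⇒hasTrue : ∀ {j} {c : Vec Bool j} → Interleaved c → HasTrue c
interleaved⇒hasTrue (true∷ _) = here refl
interleaved⇒hasTrue (false∷ h) = there h

interleaved⇒#false>0 : ∀ {j} {c : Vec Bool j} → Interleaved c → 0 < #false c
interleaved⇒#false>0 (true∷ i) = interleaved⇒#false>0 i
interleaved⇒#false>0 (false∷ _) = s≤s z≤n

shuffle-sorted : ∀ {j} (c : Vec Bool j) s t → ¬ Interleaved c → s + #true c ≤ t →
                 AllPairs _<_ (shuffle c s t)
shuffle-sorted [] s t _ _ = []
shuffle-sorted (true ∷ c) s t ¬i s+#≤t =
  All.map above-s (shuffle-inRuns t c (suc s) t s+#≤t′) ∷ shuffle-sorted c (suc s) t (¬i ∘ true∷_) s+#≤t′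
  where
  s+#≤t′ = shift-lower s _ s+#≤t
  above-s : ∀ {y} → InRuns (suc s) t t (t + #false c) y → s < y
  above-s (inj₁ (s<y , _)) = s<y
  above-s (inj₂ (t≤y , _)) = <-≤-trans (m+n≤o⇒m≤o _ s+#≤t′) t≤y
shuffle-sorted (false ∷ c) s t ¬i s+#≤t =
  All.map above-t (shuffle-inRuns (s + #true c) c s (suc t) ≤-refl)
  ∷ shuffle-sorted c s (suc t) (¬i ∘ false∷_ ∘ interleaved⇒hasTrue) (m≤n⇒m≤1+n s+#≤t)
  where
  no-lower : s + #true c ≡ s
  no-lower = trans (cong (s +_) (¬hasTrue⇒#true≡0 c (¬i ∘ false∷_))) (+-identityʳ s)
  above-t : ∀ {y} → InRuns s (s + #true c) (suc t) (suc t + #false c) y → t < y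
  above-t (inj₁ (s≤y , y<s+#)) = contradiction (≤-<-trans s≤y (subst (_ <_) no-lower y<s+#)) (n≮n s)
  above-t (inj₂ (t<y , _)) = t<y

shuffle-unsorted : ∀ {j} {c : Vec Bool j} → Interleaved c → ∀ s t → s + #true c ≤ t →
                   ¬ AllPairs _<_ (shuffle c s t)
shuffle-unsorted {c = true ∷ c} (true∷ i) s t s+#≤t (_ ∷ sorted) =
  shuffle-unsorted i (suc s) t (shift-lower s _ s+#≤t) sorted
shuffle-unsorted {c = false ∷ c} (false∷ h) s t s+#≤t (t<rest ∷ _) =
  <⇒≱ (All.lookup t<rest s∈rest) (≤-trans (m≤m+n s (#true c)) s+#≤t)
  where
  -- the lower run is nonempty, so its first letter s comes after t
  s∈rest = shuffle-covers c s (suc t) s (inj₁ (≤-refl , m<m+n s (hasTrue⇒#true>0 h)))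

firstMismatch : ∀ {j} → Vec ℕ j → ℕ → ℕ
firstMismatch [] i = 0
firstMismatch (x ∷ v) i with x ≟ i
... | yes _ = firstMismatch v (suc i)
... | no _ = x

-- In an interleaved shuffle of s, s+1, … and k, k+1, … with k = s + #true c,
-- the letters before the first upper letter are s, s+1, …, and that upper
-- letter is k; so k can be read off the word.
firstMismatch-shuffle : ∀ {j} {c : Vec Bool j} → Interleaved c → ∀ s k → k ≡ s + #true c →
                        firstMismatch (shuffle c s k) s ≡ k
firstMismatch-shuffle {c = true ∷ c} (true∷ i) s k k≡ with s ≟ s
... | yes _ = firstMismatch-shuffle i (suc s) k (trans k≡ (+-suc s (#true c)))
... | no s≢s = contradiction refl s≢s
firstMismatch-shuffle {c = false ∷ c} (false∷ h) s k k≡ with k ≟ s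
... | yes k≡s = contradiction (trans (sym k≡s) k≡) (<⇒≢ (m<m+n s (hasTrue⇒#true>0 h)))
... | no _ = refl

branch : ∀ {m} → List (Vec Bool m) → List (Vec Bool m) → List (Vec Bool (suc m))
branch xs ys = List.map (true ∷_) xs List.++ List.map (false ∷_) ys

length-branch : ∀ {m} (xs ys : List (Vec Bool m)) → length (branch xs ys) ≡ length xs + length ys
length-branch xs ys = trans (length-++ (List.map (true ∷_) xs)) (cong₂ _+_ (length-map _ xs) (length-map _ ys))

module _ {m} {xs ys : List (Vec Bool m)} where

  unique-branch : Unique xs → Unique ys → Unique (branch xs ys)
  unique-branch xs! ys! = Unique.++⁺ (Unique.map⁺ ∷-injectiveʳ xs!) (Unique.map⁺ ∷-injectiveʳ ys!) disjoint
    where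
    disjoint : ∀ {v} → ¬ (v ∈ List.map (true ∷_) xs × v ∈ List.map (false ∷_) ys)
    disjoint (v∈xs , v∈ys) with ∈-map⁻ (true ∷_) v∈xs | ∈-map⁻ (false ∷_) v∈ys
    ... | _ , _ , refl | _ , _ , ()

  ∈-branch⁺ : ∀ x {b} → b ∈ (if x then xs else ys) → (x ∷ b) ∈ branch xs ys
  ∈-branch⁺ true b∈xs = ∈-++⁺ˡ (∈-map⁺ (true ∷_) b∈xs)
  ∈-branch⁺ false b∈ys = ∈-++⁺ʳ (List.map (true ∷_) xs) (∈-map⁺ (false ∷_) b∈ys)

  ∈-branch⁻ : ∀ x {b} → (x ∷ b) ∈ branch xs ys → b ∈ (if x then xs else ys)
  ∈-branch⁻ x x∷b∈ with ∈-++⁻ (List.map (true ∷_) xs) x∷b∈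
  ... | inj₁ ∈xs with ∈-map⁻ (true ∷_) ∈xs
  ...   | _ , b∈xs , refl = b∈xs
  ∈-branch⁻ x x∷b∈ | inj₂ ∈ys with ∈-map⁻ (false ∷_) ∈ys
  ...   | _ , b∈ys , refl = b∈ys

allVecs : ∀ m → List (Vec Bool m)
allVecs zero = [] ∷ []
allVecs (suc m) = branch (allVecs m) (allVecs m)

hasTrueVecs : ∀ m → List (Vec Bool m)
hasTrueVecs zero = []
hasTrueVecs (suc m) = branch (allVecs m) (hasTrueVecs m)

interleavedVecs : ∀ m → List (Vec Bool m)
interleavedVecs zero = []
interleavedVecs (suc m) = branch (interleavedVecs m) (hasTrueVecs m)

unique-allVecs : ∀ m → Unique (allVecs m)
unique-allVecs zero = ListAll.[] ∷ []
unique-allVecs (suc m) = unique-branch (unique-allVecs m) (unique-allVecs m)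

unique-hasTrueVecs : ∀ m → Unique (hasTrueVecs m)
unique-hasTrueVecs zero = []
unique-hasTrueVecs (suc m) = unique-branch (unique-allVecs m) (unique-hasTrueVecs m)

unique-interleavedVecs : ∀ m → Unique (interleavedVecs m)
unique-interleavedVecs zero = []
unique-interleavedVecs (suc m) = unique-branch (unique-interleavedVecs m) (unique-hasTrueVecs m)

∈-allVecs : ∀ {m} (b : Vec Bool m) → b ∈ allVecs m
∈-allVecs [] = ListAny.here refl
∈-allVecs (true ∷ b) = ∈-branch⁺ true (∈-allVecs b)
∈-allVecs (false ∷ b) = ∈-branch⁺ false (∈-allVecs b)

∈-hasTrueVecs⁺ : ∀ {m} {b : Vec Bool m} → HasTrue b → b ∈ hasTrueVecs m
∈-hasTrueVecs⁺ {b = true ∷ b} _ = ∈-branch⁺ true (∈-allVecs b)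
∈-hasTrueVecs⁺ {b = false ∷ b} (there h) = ∈-branch⁺ false (∈-hasTrueVecs⁺ h)

∈-hasTrueVecs⁻ : ∀ {m} (b : Vec Bool m) → b ∈ hasTrueVecs m → HasTrue b
∈-hasTrueVecs⁻ (true ∷ b) _ = here refl
∈-hasTrueVecs⁻ (false ∷ b) b∈ = there (∈-hasTrueVecs⁻ b (∈-branch⁻ false b∈))

∈-interleavedVecs⁺ : ∀ {m} {b : Vec Bool m} → Interleaved b → b ∈ interleavedVecs m
∈-interleavedVecs⁺ (true∷ i) = ∈-branch⁺ true (∈-interleavedVecs⁺ i)
∈-interleavedVecs⁺ (false∷ h) = ∈-branch⁺ false (∈-hasTrueVecs⁺ h)

∈-interleavedVecs⁻ : ∀ {m} (b : Vec Bool m) → b ∈ interleavedVecs m → Interleaved b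
∈-interleavedVecs⁻ (true ∷ b) b∈ = true∷ ∈-interleavedVecs⁻ b (∈-branch⁻ true b∈)
∈-interleavedVecs⁻ (false ∷ b) b∈ = false∷ ∈-hasTrueVecs⁻ b (∈-branch⁻ false b∈)

-- Bounds needed for the truncated subtractions in the counts.
1≤2^ : ∀ m → 1 ≤ 2 ^ m
1≤2^ = m^n>0 2

m<2^ : ∀ m → m < 2 ^ m
m<2^ zero = ≤-refl
m<2^ (suc m) = +-mono-≤ (1≤2^ m) (≤-trans (m<2^ m) (m≤m+n (2 ^ m) 0))

length-allVecs : ∀ m → length (allVecs m) ≡ 2 ^ m
length-allVecs zero = refl
length-allVecs (suc m) = begin
  length (branch (allVecs m) (allVecs m)) ≡⟨ length-branch (allVecs m) (allVecs m) ⟩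
  length (allVecs m) + length (allVecs m) ≡⟨ cong₂ _+_ (length-allVecs m) (length-allVecs m) ⟩
  2 ^ m + 2 ^ m                           ≡⟨ cong (2 ^ m +_) (sym (+-identityʳ (2 ^ m))) ⟩
  2 ^ suc m                               ∎
  where open ≡-Reasoning

length-hasTrueVecs : ∀ m → length (hasTrueVecs m) ≡ 2 ^ m ∸ 1
length-hasTrueVecs zero = refl
length-hasTrueVecs (suc m) = begin
  length (branch (allVecs m) (hasTrueVecs m)) ≡⟨ length-branch (allVecs m) (hasTrueVecs m) ⟩
  length (allVecs m) + length (hasTrueVecs m) ≡⟨ cong₂ _+_ (length-allVecs m) (length-hasTrueVecs m) ⟩
  2 ^ m + (2 ^ m ∸ 1)                         ≡⟨ sym (+-∸-assoc (2 ^ m) (1≤2^ m)) ⟩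
  (2 ^ m + 2 ^ m) ∸ 1                         ≡⟨ cong (λ x → (2 ^ m + x) ∸ 1) (sym (+-identityʳ (2 ^ m))) ⟩
  2 ^ suc m ∸ 1                               ∎
  where open ≡-Reasoning

-- Exactly m + 1 vectors of length m, namely true⋯true false⋯false, are not
-- interleaved.
length-interleavedVecs : ∀ m → length (interleavedVecs m) ≡ 2 ^ m ∸ suc m
length-interleavedVecs zero = refl
length-interleavedVecs (suc m) = begin
  length (branch (interleavedVecs m) (hasTrueVecs m))    ≡⟨ length-branch (interleavedVecs m) (hasTrueVecs m) ⟩
  length (interleavedVecs m) + length (hasTrueVecs m)    ≡⟨ cong₂ _+_ (length-interleavedVecs m) (length-hasTrueVecs m) ⟩
  (2 ^ m ∸ suc m) + (2 ^ m ∸ 1)                          ≡⟨ sym (+-∸-assoc (2 ^ m ∸ suc m) (1≤2^ m)) ⟩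
  ((2 ^ m ∸ suc m) + 2 ^ m) ∸ 1                          ≡⟨ cong (_∸ 1) (sym (+-∸-comm (2 ^ m) (m<2^ m))) ⟩
  ((2 ^ m + 2 ^ m) ∸ suc m) ∸ 1                          ≡⟨ ∸-+-assoc (2 ^ m + 2 ^ m) (suc m) 1 ⟩
  (2 ^ m + 2 ^ m) ∸ (suc m + 1)                          ≡⟨ cong₂ _∸_ (cong (2 ^ m +_) (sym (+-identityʳ (2 ^ m)))) (+-comm (suc m) 1) ⟩
  2 ^ suc m ∸ suc (suc m)                                ∎
  where open ≡-Reasoning

allPairs-lookup : ∀ {j} {R : ℕ → ℕ → Set} {v : Vec ℕ j} → AllPairs R v →
                  ∀ (p q : Fin j) → toℕ p < toℕ q → R (lookup v p) (lookup v q)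
allPairs-lookup (x≺v ∷ _) zero (suc q) _ = lookup⁺ x≺v q
allPairs-lookup (_ ∷ ordered) (suc p) (suc q) (s≤s p<q) = allPairs-lookup ordered p q p<q

lookup-allPairs : ∀ {j} {R : ℕ → ℕ → Set} (v : Vec ℕ j) →
                  (∀ (p q : Fin j) → toℕ p < toℕ q → R (lookup v p) (lookup v q)) → AllPairs R v
lookup-allPairs [] _ = []
lookup-allPairs (x ∷ v) R-lookup =
  lookup⁻ (λ q → R-lookup zero (suc q) (s≤s z≤n)) ∷ lookup-allPairs v (λ p q p<q → R-lookup (suc p) (suc q) (s≤s p<q))

injective⇒surjective : ∀ {n} (f : Fin n → Fin n) → Injective _≡_ _≡_ f → ∀ y → Σ (Fin n) λ i → f i ≡ y
injective⇒surjective {zero} f _ ()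
injective⇒surjective {suc m} f inj y with any? (λ i → f i ≟ᶠ y)
... | yes hit = hit
... | no miss with pigeonhole (n<1+n m) (λ i → punchOut {i = y} {j = f i} (miss ∘ (i ,_) ∘ sym))
... | i , j , i<j , eq =
  contradiction (inj (punchOut-injective (miss ∘ (i ,_) ∘ sym) (miss ∘ (j ,_) ∘ sym) eq)) (λ i≡j → <-irrefl (cong toℕ i≡j) i<j)

letters : ∀ {n j} → Vec (Fin n) j → Vec ℕ j
letters = Vec.map toℕ

lookup-letters : ∀ {n j} (w : Vec (Fin n) j) p → lookup (letters w) p ≡ toℕ (lookup w p)
lookup-letters w p = lookup-map p toℕ w

letters-injective : ∀ {n j} (w w′ : Vec (Fin n) j) → letters w ≡ letters w′ → w ≡ w′
letters-injective [] [] _ = refl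
letters-injective (a ∷ w) (a′ ∷ w′) eq with ∷-injective eq
... | a≡a′ , w≡w′ = cong₂ _∷_ (toℕ-injective a≡a′) (letters-injective w w′ w≡w′)

toWord : ∀ {n j} {v : Vec ℕ j} → All (_< n) v → Vec (Fin n) j
toWord = All.reduce (λ x<n → fromℕ< x<n)

letters-toWord : ∀ {n j} {v : Vec ℕ j} (v<n : All (_< n) v) → letters (toWord v<n) ≡ v
letters-toWord [] = refl
letters-toWord (x<n ∷ v<n) = cong₂ _∷_ (toℕ-fromℕ< x<n) (letters-toWord v<n)

InBlock : ℕ → ℕ → ℕ → Set
InBlock s ℓ x = s ≤ x × x < s + ℓ

sameLetter : ∀ {n j} (w : Vec (Fin n) j) {p q} → lookup w p ≡ lookup w q → lookup (letters w) p ≡ lookup (letters w) q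
sameLetter w {p} {q} eq = trans (lookup-letters w p) (trans (cong toℕ eq) (sym (lookup-letters w q)))

allPairs⇒injective : ∀ {n j} {R : ℕ → ℕ → Set} (w : Vec (Fin n) j) → (∀ {x y} → R x y → x ≢ y) →
                     AllPairs R (letters w) → Injective _≡_ _≡_ (lookup w)
allPairs⇒injective w R⇒≢ ordered {p} {q} wp≡wq with <-cmp (toℕ p) (toℕ q)
... | tri< p<q _ _ = contradiction (sameLetter w wp≡wq) (R⇒≢ (allPairs-lookup ordered p q p<q))
... | tri≈ _ p≡q _ = toℕ-injective p≡q
... | tri> _ _ q<p = contradiction (sameLetter w (sym wp≡wq)) (R⇒≢ (allPairs-lookup ordered q p q<p))

module _ {n} (w : Word n) (inj : Injective _≡_ _≡_ (lookup w)) where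

  letters-complete : ∀ y → y < n → y ∈ᵥ letters w
  letters-complete y y<n with injective⇒surjective (lookup w) inj (fromℕ< y<n)
  ... | p , wp≡y = subst (_∈ᵥ letters w) (trans (lookup-letters w p) (trans (cong toℕ wp≡y) (toℕ-fromℕ< y<n)))
                         (∈-lookup p (letters w))

  increasingBlock-ordered : ∀ {s ℓ} → IncreasingBlock w s ℓ → ∀ p q → toℕ p < toℕ q →
    InBlock s ℓ (lookup (letters w) p) → InBlock s ℓ (lookup (letters w) q) →
    lookup (letters w) p < lookup (letters w) q
  increasingBlock-ordered increasing p q p<q (_ , x<s+ℓ) (s≤y , _)
    rewrite lookup-letters w p | lookup-letters w q with <-cmp (toℕ (lookup w p)) (toℕ (lookup w q))
  ... | tri< x<y _ _ = x<y
  ... | tri≈ _ x≡y _ = contradiction (cong toℕ (inj (toℕ-injective x≡y))) (<⇒≢ p<q)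
  ... | tri> _ _ y<x with increasing (lookup w q) (lookup w p) s≤y y<x x<s+ℓ
  ...   | p′ , q′ , p′<q′ , wp′≡wq , wq′≡wp =
    contradiction (subst₂ (λ i j → toℕ i < toℕ j) (inj wp′≡wq) (inj wq′≡wp) p′<q′) (<-asym p<q)

  allPairs⇒increasingBlock : ∀ {R : ℕ → ℕ → Set} {s ℓ} → AllPairs R (letters w) →
    (∀ {x y} → InBlock s ℓ x → InBlock s ℓ y → R x y → x < y) → IncreasingBlock w s ℓ
  allPairs⇒increasingBlock {R} {s} {ℓ} ordered forces a b s≤a a<b b<s+ℓ
    with injective⇒surjective (lookup w) inj a | injective⇒surjective (lookup w) inj b
  ... | p , wp≡a | q , wq≡b with <-cmp (toℕ p) (toℕ q)
  ... | tri< p<q _ _ = p , q , p<q , wp≡a , wq≡b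
  ... | tri≈ _ p≡q _ = contradiction (cong toℕ (trans (sym wp≡a) (trans (cong (lookup w) (toℕ-injective p≡q)) wq≡b))) (<⇒≢ a<b)
  ... | tri> _ _ q<p = contradiction (forces b∈ a∈ b≺a) (<-asym a<b)
    where
    letter : ∀ {r c} → lookup w r ≡ c → lookup (letters w) r ≡ toℕ c
    letter {r} wr≡c = trans (lookup-letters w r) (cong toℕ wr≡c)
    a∈ : InBlock s ℓ (toℕ a)
    a∈ = s≤a , <-trans a<b b<s+ℓ
    b∈ : InBlock s ℓ (toℕ b)
    b∈ = ≤-trans s≤a (<⇒≤ a<b) , b<s+ℓ
    b≺a : R (toℕ b) (toℕ a)
    b≺a = subst₂ R (letter wq≡b) (letter wp≡a) (allPairs-lookup ordered q p q<p)

  singleBlock⇒sorted : ∀ {ℓ} → ValidPartition w (ℓ ∷ []) → AllPairs _<_ (letters w)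
  singleBlock⇒sorted {ℓ} (ℓ+0≡n , (_ , increasing , _)) =
    lookup-allPairs (letters w) λ p q p<q → increasingBlock-ordered increasing p q p<q (z≤n , below p) (z≤n , below q)
    where
    below : ∀ p → lookup (letters w) p < ℓ
    below p = subst₂ _<_ (sym (lookup-letters w p)) (trans (sym ℓ+0≡n) (+-identityʳ ℓ)) (toℕ<n (lookup w p))

  sorted⇒singleBlock : 0 < n → AllPairs _<_ (letters w) → ValidPartition w (n ∷ [])
  sorted⇒singleBlock 0<n sorted = +-identityʳ n , 0<n , allPairs⇒increasingBlock sorted (λ _ _ x<y → x<y) , tt

  unsorted⇒twoBlocks : 0 < n → ¬ AllPairs _<_ (letters w) → ∀ ls → ValidPartition w ls → 2 ≤ length ls
  unsorted⇒twoBlocks 0<n _ [] (0≡n , _) = contradiction 0≡n (<⇒≢ 0<n)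
  unsorted⇒twoBlocks _ unsorted (_ ∷ []) single = contradiction (singleBlock⇒sorted single) unsorted
  unsorted⇒twoBlocks _ _ (_ ∷ _ ∷ _) _ = s≤s (s≤s z≤n)

module _ {n} (w : Word n) (inj : Injective _≡_ _≡_ (lookup w)) {k ℓ : ℕ} where

  runOrdered⇒blocks : AllPairs (RunOrdered k) (letters w) → IncreasingBlock w 0 k × IncreasingBlock w k ℓ
  runOrdered⇒blocks ordered =
      allPairs⇒increasingBlock w inj ordered (λ (_ , x<k) (_ , y<k) x≺y → proj₁ x≺y x<k y<k)
    , allPairs⇒increasingBlock w inj ordered (λ (k≤x , _) (k≤y , _) x≺y → proj₂ x≺y k≤x k≤y)

  blocks⇒runOrdered : k + ℓ ≡ n → IncreasingBlock w 0 k → IncreasingBlock w k ℓ →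
                      AllPairs (RunOrdered k) (letters w)
  blocks⇒runOrdered k+ℓ≡n lower upper = lookup-allPairs (letters w) λ p q p<q →
      (λ x<k y<k → increasingBlock-ordered w inj lower p q p<q (z≤n , x<k) (z≤n , y<k))
    , (λ k≤x k≤y → increasingBlock-ordered w inj upper p q p<q (k≤x , below p) (k≤y , below q))
    where
    below : ∀ p → lookup (letters w) p < k + ℓ
    below p = subst₂ _<_ (sym (lookup-letters w p)) (sym k+ℓ≡n) (toℕ<n (lookup w p))

encodeLetters : ∀ {m} → Vec Bool m → Vec ℕ (suc m)
encodeLetters b = shuffle (true ∷ b) 0 (suc (#true b))

encodeLetters-inRuns : ∀ {m} (b : Vec Bool m) →
  All (InRuns 0 (suc (#true b)) (suc (#true b)) (suc m)) (encodeLetters b)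
encodeLetters-inRuns {m} b = subst (λ N → All (InRuns 0 K K N) (encodeLetters b)) (cong suc (#true+#false b))
  (shuffle-inRuns K (true ∷ b) 0 K ≤-refl)
  where K = suc (#true b)

encodeLetters-bounded : ∀ {m} (b : Vec Bool m) → All (_< suc m) (encodeLetters b)
encodeLetters-bounded {m} b = All.map (inRuns⇒< K≤n) (encodeLetters-inRuns b)
  where
  K≤n : suc (#true b) ≤ suc m
  K≤n = s≤s (subst (#true b ≤_) (#true+#false b) (m≤m+n _ _))

encode : ∀ {m} → Vec Bool m → Word (suc m)
encode b = toWord (encodeLetters-bounded b)

letters-encode : ∀ {m} (b : Vec Bool m) → letters (encode b) ≡ encodeLetters b
letters-encode b = letters-toWord (encodeLetters-bounded b)

-- Reading b back: K is the first letter out of place, and the pattern is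
-- the classification of the letters by K.
decode : ∀ {m} → Word (suc m) → Vec Bool m
decode w = tail (classify (firstMismatch (letters w) 0) (letters w))

decode-encode : ∀ {m} {b : Vec Bool m} → Interleaved b → decode (encode b) ≡ b
decode-encode {b = b} i = begin
  tail (classify (firstMismatch (letters (encode b)) 0) (letters (encode b)))
    ≡⟨ cong (λ v → tail (classify (firstMismatch v 0) v)) (letters-encode b) ⟩
  tail (classify (firstMismatch (encodeLetters b) 0) (encodeLetters b))
    ≡⟨ cong (λ K → tail (classify K (encodeLetters b))) (firstMismatch-shuffle (true∷ i) 0 K refl) ⟩
  tail (classify K (encodeLetters b))
    ≡⟨ cong tail (classify-shuffle K (true ∷ b) 0 K ≤-refl ≤-refl) ⟩
  b ∎
  where
  open ≡-Reasoning
  K = suc (#true b)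

encode-twoStandard : ∀ {m} {b : Vec Bool m} → Interleaved b → TwoStandardConsecutive (encode b)
encode-twoStandard {m} {b} i =
  (injective , fixes-first) , ((K ∷ #false b ∷ []) , partition , refl) , unsorted⇒twoBlocks w injective (s≤s z≤n) unsorted
  where
  K = suc (#true b)
  w = encode b
  ordered : AllPairs (RunOrdered K) (letters w)
  ordered = subst (AllPairs (RunOrdered K)) (sym (letters-encode b)) (shuffle-runOrdered K (true ∷ b) 0 K ≤-refl ≤-refl)
  injective : Injective _≡_ _≡_ (lookup w)
  injective = allPairs⇒injective w RunOrdered⇒≢ ordered
  fixes-first : ∀ z → toℕ z ≡ 0 → lookup w z ≡ z
  fixes-first zero _ = toℕ-injective (trans (sym (lookup-letters w zero)) (cong (λ v → lookup v zero) (letters-encode b)))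
  blocks = runOrdered⇒blocks w injective ordered
  partition : ValidPartition w (K ∷ #false b ∷ [])
  partition = cong suc (trans (cong (#true b +_) (+-identityʳ _)) (#true+#false b))
            , s≤s z≤n , proj₁ blocks , interleaved⇒#false>0 i , proj₂ blocks , tt
  unsorted : ¬ AllPairs _<_ (letters w)
  unsorted sorted = shuffle-unsorted (true∷ i) 0 K ≤-refl (subst (AllPairs _<_) (letters-encode b) sorted)

twoBlocks⇒encode : ∀ {m k ℓ} (w : Word (suc m)) → IsCycleWord w → 0 < k → k + ℓ ≡ suc m →
                   IncreasingBlock w 0 k → IncreasingBlock w k ℓ →
                   Σ (Vec Bool m) λ b → letters w ≡ encodeLetters b
twoBlocks⇒encode {m} {k} {ℓ} (a ∷ w′) (injective , fixes-first) 0<k k+ℓ≡n lower upper = b , letters≡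
  where
  w = a ∷ w′
  k≤n : k ≤ suc m
  k≤n = subst (k ≤_) k+ℓ≡n (m≤m+n k ℓ)
  twoRun : TwoRunWord k (letters w) 0 k (suc m)
  twoRun = blocks⇒runOrdered w injective k+ℓ≡n lower upper
         , All.map <⇒inRuns (map⁺ (All.universal toℕ<n w))
         , (λ y y∈runs → letters-complete w injective y (inRuns⇒< k≤n y∈runs))
  shuffled = twoRunWord⇒shuffle k (letters w) 0 k (suc m) z≤n ≤-refl twoRun
  b = classify k (letters w′)
  -- the first letter is 0, which lies in the lower run
  classify≡ : classify k (letters w) ≡ true ∷ b
  classify≡ = cong (_∷ b) (trans (cong (λ x → ⌊ toℕ x <? k ⌋) (fixes-first zero refl))
                                 (trans (isYes≗does (0 <? k)) (dec-true (0 <? k) 0<k)))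
  K≡k : suc (#true b) ≡ k
  K≡k = trans (cong #true (sym classify≡)) (proj₂ shuffled)
  letters≡ : letters w ≡ encodeLetters b
  letters≡ = trans (proj₁ shuffled) (cong₂ (λ c t → shuffle c 0 t) classify≡ (sym K≡k))

-- Every 2-standard consecutive cycle encodes an interleaved pattern: the
-- pattern of a non-interleaved one would make the cycle a single block.
twoStandard⇒encode : ∀ {m} (w : Word (suc m)) → TwoStandardConsecutive w →
                     Σ (Vec Bool m) λ b → Interleaved b × w ≡ encode b
twoStandard⇒encode w (_ , (([] , _ , ()) , _))
twoStandard⇒encode w (_ , ((_ ∷ [] , _ , ()) , _))
twoStandard⇒encode w (_ , ((_ ∷ _ ∷ _ ∷ _ , _ , ()) , _))
twoStandard⇒encode {m} w (cycle , ((k ∷ ℓ ∷ [] , (sum≡ , 0<k , lower , _ , upper , _) , _) , minimal))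
  with twoBlocks⇒encode w cycle 0<k (trans (cong (k +_) (sym (+-identityʳ ℓ))) sum≡) lower upper
... | b , letters≡ = b , b-interleaved , letters-injective w (encode b) (trans letters≡ (sym (letters-encode b)))
  where
  b-interleaved : Interleaved b
  b-interleaved with interleaved? b
  ... | yes i = i
  ... | no ¬i = contradiction (minimal (suc m ∷ []) (sorted⇒singleBlock w (proj₁ cycle) (s≤s z≤n) sorted)) λ { (s≤s ()) }
    where
    sorted : AllPairs _<_ (letters w)
    sorted = subst (AllPairs _<_) (sym letters≡) (shuffle-sorted (true ∷ b) 0 _ (λ { (true∷ i) → ¬i i }) ≤-refl)

unique-map : ∀ {A B : Set} {f : A → B} (g : B → A) {xs : List A} →
             ListAll.All (λ x → g (f x) ≡ x) xs → Unique xs → Unique (List.map f xs)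
unique-map {f = f} g {xs} g∘f≡id xs! =
  Unique.map⁻ {f = g} (subst Unique (sym (trans (sym (map-∘ xs)) (map-id-local g∘f≡id))) xs!)

mainTheorem4 : ∀ (n : ℕ) → 1 ≤ n →
    Σ (List (Vec (Fin n) n)) λ T →
    Unique T × (∀ w → (w ∈ T) ⇔ TwoStandardConsecutive w) × length T ≡ 2 ^ (n ∸ 1) ∸ n
mainTheorem4 (suc m) _ =
  List.map encode (interleavedVecs m) , unique , (λ w → mk⇔ (sound w) (complete w)) ,
  trans (length-map encode (interleavedVecs m)) (length-interleavedVecs m)
  where
  unique : Unique (List.map encode (interleavedVecs m))
  unique = unique-map decode (ListAll.tabulate (λ {b} b∈ → decode-encode (∈-interleavedVecs⁻ b b∈)))
                      (unique-interleavedVecs m)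
  sound : ∀ w → w ∈ List.map encode (interleavedVecs m) → TwoStandardConsecutive w
  sound w w∈ with ∈-map⁻ encode w∈
  ... | b , b∈ , refl = encode-twoStandard (∈-interleavedVecs⁻ b b∈)
  complete : ∀ w → TwoStandardConsecutive w → w ∈ List.map encode (interleavedVecs m)
  complete w twoStandard with twoStandard⇒encode w twoStandard
  ... | b , b-interleaved , refl = ∈-map⁺ encode (∈-interleavedVecs⁺ b-interleaved)
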